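{- For a nonnegative integer $n$ and an index $\boldsymbol{k}=(k_1,\dots,k_r)$, \[\sum_{i=0}^n{}_iI_{n-i}(\boldsymbol{k})=\sigma_n(I_0(\boldsymbol{k})).\]
   Context: An index is a finite sequence of positive integers, including $\emptyset$; $\mathcal{I}$ is the $\mathbb{Q}$-vector space with basis the indices. The harmonic product $*$ on $\mathcal{I}$ is bilinear with $\emptyset*\boldsymbol{k}=\boldsymbol{k}*\emptyset=\boldsymbol{k}$ and $(\boldsymbol{k},k)*(\boldsymbol{l},l)=(\boldsymbol{k}*(\boldsymbol{l},l),k)+((\boldsymbol{k},k)*\boldsymbol{l},l)+(\boldsymbol{k}*\boldsymbol{l},k+l)$. For $n\ge0$, $\sigma_n$ is the linear map $\sigma_n(k_1,\dots,k_r)=\sum_{l_1+\dots+l_r=n,\ l_i\ge0}(k_1+l_1,\dots,k_r+l_r)\prod_i\binom{k_i+l_i-1}{l_i}$, $\sigma_n(\emptyset)=\delta_{n,0}$. For $m,n\ge0$, ${}_mI_n:\mathcal{I}\to\mathcal{I}$ is linear with ${}_mI_n(k_1,\dots,k_r)=\sum_{i=0}^r(-1)^{k_r+\dots+k_{i+1}}\sigma_m(k_1,\dots,k_i)*\sigma_n(k_r,\dots,k_{i+1})$, and $I_n:={}_0I_n$. -}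

module Defs where

open import Data.Nat as ℕ using (ℕ; zero; suc; _∸_)
open import Data.Nat.Combinatorics using (_C_)
open import Data.List using (List; []; _∷_; _++_; map; concatMap; reverse; take; drop; length; upTo; foldr)
open import Data.Nat.ListAction using (sum)
open import Data.List.Properties using (≡-dec)
open import Data.Product using (_×_; _,_)
open import Data.Rational as ℚ using (ℚ; 0ℚ; 1ℚ)
open import Relation.Nullary using (yes; no)
open import Data.Integer using (+_)
open import Relation.Binary.PropositionalEquality using (_≡_)

-- An index is a list of naturals (positivity is imposed as a hypothesis
-- in the statement; all operations below preserve positivity).
Index : Set
Index = List ℕ

-- An element of the Q-vector space 𝓘 with basis the indices,
-- represented as a formal (unnormalised) linear combination.
Lin : Set
Lin = List (ℚ × Index)

coeff : Lin → Index → ℚ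
coeff [] w = 0ℚ
coeff ((c , k) ∷ xs) w with ≡-dec ℕ._≟_ k w
... | yes _ = c ℚ.+ coeff xs w
... | no _  = coeff xs w

_≈_ : Lin → Lin → Set
x ≈ y = ∀ w → coeff x w ≡ coeff y w

infix 4 _≈_

basis : Index → Lin
basis k = (1ℚ , k) ∷ []

_⊕_ : Lin → Lin → Lin
x ⊕ y = x ++ y

infixl 6 _⊕_

scale : ℚ → Lin → Lin
scale c = map (λ { (d , k) → (c ℚ.* d , k) })

linExt : (Index → Lin) → Lin → Lin
linExt f = concatMap (λ { (c , k) → scale c (f k) })

bilinExt : (Index → Index → Lin) → Lin → Lin → Lin
bilinExt f x y =
  concatMap (λ { (c , k) → concatMap (λ { (d , l) → scale (c ℚ.* d) (f k l) }) y }) x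

-- harmonic product on reversed indices (head of the list = last entry)
harmRev : Index → Index → Lin
harmRev [] l = basis l
harmRev (k ∷ ks) [] = basis (k ∷ ks)
harmRev (k ∷ ks) (l ∷ ls) =
     map (λ { (c , w) → (c , k ∷ w) }) (harmRev ks (l ∷ ls))
  ⊕ map (λ { (c , w) → (c , l ∷ w) }) (harmRev (k ∷ ks) ls)
  ⊕ map (λ { (c , w) → (c , (k ℕ.+ l) ∷ w) }) (harmRev ks ls)

-- harmonic product of two indices:
-- (k,k)*(l,l) = (k*(l,l),k) + ((k,k)*l,l) + (k*l,k+l)
harmIdx : Index → Index → Lin
harmIdx k l = map (λ { (c , w) → (c , reverse w) }) (harmRev (reverse k) (reverse l))

_⋆_ : Lin → Lin → Lin
_⋆_ = bilinExt harmIdx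

infixl 7 _⋆_

ℕtoℚ : ℕ → ℚ
ℕtoℚ n = + n ℚ./ 1

σIdx : ℕ → Index → Lin
σIdx zero [] = basis []
σIdx (suc n) [] = []
σIdx n (k ∷ ks) =
  concatMap (λ l → map (λ { (c , w) → (ℕtoℚ ((k ℕ.+ l ∸ 1) C l) ℚ.* c , (k ℕ.+ l) ∷ w) })
                       (σIdx (n ∸ l) ks))
            (upTo (suc n))

σ : ℕ → Lin → Lin
σ n = linExt (σIdx n)

sgn : ℕ → ℚ
sgn zero = 1ℚ
sgn (suc s) = ℚ.- sgn s

IIdx : ℕ → ℕ → Index → Lin
IIdx m n k =
  concatMap (λ i → scale (sgn (sum (drop i k)))
                         (σ m (basis (take i k)) ⋆ σ n (basis (reverse (drop i k)))))
            (upTo (suc (length k)))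

I₂ : ℕ → ℕ → Lin → Lin
I₂ m n = linExt (IIdx m n)

I : ℕ → Lin → Lin
I n = I₂ 0 n

Σ≤ : ℕ → (ℕ → Lin) → Lin
Σ≤ n f = concatMap f (upTo (suc n))

-- Put σₜ = ∑ₙ σₙ tⁿ. It replaces every entry k of an index by ∑ₐ (k multichoose a) tᵃ (k + a), the
-- expansion of (1 - t)⁻ᵏ. By Vandermonde, (1 - t)⁻ᵏ (1 - t)⁻ˡ = (1 - t)⁻⁽ᵏ⁺ˡ⁾, this substitution
-- respects merging two entries k, l into k + l; since the three terms of the harmonic product keep k,
-- keep l or merge the two, induction along its recursion shows that σₜ is multiplicative:
-- σₙ(a * b) = ∑_{i+j=n} σᵢ(a) * σⱼ(b). Applied to the terms ±(k₁,…,kᵢ) * (k_r,…,k_{i+1}) of I₀(k),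
-- with σ₀ = id, this is the statement. The harmonic product is computed on reversed indices, so we
-- also use that an entry-wise substitution commutes with reversal.
--
-- Elements of 𝓘 are unnormalised formal sums; they are compared through their pairings ⟨ g ∣ x ⟩
-- with all g : Index → ℚ, and each linear map enters through its transpose (σᵀ, harmRevᵀ, …).

module Submission where

open import Defs
open import Data.Nat as ℕ using (ℕ; zero; suc; _∸_; NonZero)
import Data.Nat.Properties as ℕₚ
open import Data.Nat.ListAction using (sum)
open import Data.Nat.Combinatorics using (_C_; nCk+nC[k+1]≡[n+1]C[k+1]; k>n⇒nCk≡0)
import Data.Integer as ℤ
import Data.Integer.Properties as ℤₚ
open import Data.Rational as ℚ using (ℚ; mkℚ; toℚᵘ; 0ℚ; 1ℚ; _+_; _*_)
open import Data.Rational.Properties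
import Data.Rational.Unnormalised as ℚᵘ
import Data.Rational.Unnormalised.Properties as ℚᵘₚ
open import Data.Nat.Coprimality using (1-coprimeTo) renaming (sym to Coprime-sym)
open import Data.List
  using (List; []; _∷_; [_]; _++_; map; concatMap; reverse; upTo; applyUpTo; take; drop; length)
open import Data.List.Properties using (map-upTo; unfold-reverse; ≡-dec)
open import Data.List.Relation.Unary.All using (All)
open import Data.Product as Product using (_,_; map₂)
open import Function using (_∘_; flip; id)
open import Relation.Binary.PropositionalEquality hiding ([_])
open import Relation.Nullary using (yes; no)

open import Algebra.Bundles using (CommutativeMonoid)
open import Algebra.Properties.CommutativeSemigroup
  (CommutativeMonoid.commutativeSemigroup +-0-commutativeMonoid)
  using (interchange) renaming (x∙yz≈y∙xz to x+[y+z]≡y+[x+z])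
open import Algebra.Properties.CommutativeSemigroup
  (CommutativeMonoid.commutativeSemigroup *-1-commutativeMonoid)
  using () renaming (x∙yz≈y∙xz to x*[y*z]≡y*[x*z])
open import Algebra.Properties.CommutativeSemigroup ℕₚ.+-commutativeSemigroup
  using () renaming (interchange to ℕ-+-interchange)

ℕtoℚ-+ : ∀ m n → ℕtoℚ (m ℕ.+ n) ≡ ℕtoℚ m + ℕtoℚ n
ℕtoℚ-+ m n = toℚᵘ-injective (begin
  toℚᵘ (ℕtoℚ (m ℕ.+ n))
    ≡⟨ cong toℚᵘ (ℕtoℚ≡mkℚ (m ℕ.+ n)) ⟩
  ℚᵘ.mkℚᵘ (ℤ.+ (m ℕ.+ n)) 0
    ≈⟨ ℚᵘ.*≡* (trans (ℤₚ.*-identityʳ _) (sym (trans (ℤₚ.*-identityʳ _)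
         (cong₂ ℤ._+_ (ℤₚ.*-identityʳ (ℤ.+ m)) (ℤₚ.*-identityʳ (ℤ.+ n)))))) ⟩
  ℚᵘ.mkℚᵘ (ℤ.+ m) 0 ℚᵘ.+ ℚᵘ.mkℚᵘ (ℤ.+ n) 0
    ≡⟨ cong₂ ℚᵘ._+_ (cong toℚᵘ (ℕtoℚ≡mkℚ m)) (cong toℚᵘ (ℕtoℚ≡mkℚ n)) ⟨
  toℚᵘ (ℕtoℚ m) ℚᵘ.+ toℚᵘ (ℕtoℚ n)
    ≈⟨ toℚᵘ-homo-+ (ℕtoℚ m) (ℕtoℚ n) ⟨
  toℚᵘ (ℕtoℚ m + ℕtoℚ n)
    ∎)
  where
  open ℚᵘₚ.≃-Reasoning
  ℕtoℚ≡mkℚ : ∀ k → ℕtoℚ k ≡ mkℚ (ℤ.+ k) 0 (Coprime-sym (1-coprimeTo k))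
  ℕtoℚ≡mkℚ k = normalize-coprime (Coprime-sym (1-coprimeTo k))

open ≡-Reasoning

private
  variable
    A B : Set

∑ : List A → (A → ℚ) → ℚ
∑ []       f = 0ℚ
∑ (a ∷ as) f = f a + ∑ as f

∑-cong : ∀ {f g : A → ℚ} as → (∀ a → f a ≡ g a) → ∑ as f ≡ ∑ as g
∑-cong []       f≗g = refl
∑-cong (a ∷ as) f≗g = cong₂ _+_ (f≗g a) (∑-cong as f≗g)

∑-++ : ∀ as bs (f : A → ℚ) → ∑ (as ++ bs) f ≡ ∑ as f + ∑ bs f
∑-++ []       bs f = sym (+-identityˡ _)
∑-++ (a ∷ as) bs f = trans (cong (f a +_) (∑-++ as bs f)) (sym (+-assoc (f a) (∑ as f) (∑ bs f)))

∑-map : ∀ (h : B → A) bs (f : A → ℚ) → ∑ (map h bs) f ≡ ∑ bs (f ∘ h)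
∑-map h []       f = refl
∑-map h (b ∷ bs) f = cong (f (h b) +_) (∑-map h bs f)

∑-concatMap : ∀ (h : A → List B) as (f : B → ℚ) →
              ∑ (concatMap h as) f ≡ ∑ as (λ a → ∑ (h a) f)
∑-concatMap h []       f = refl
∑-concatMap h (a ∷ as) f = trans (∑-++ (h a) _ f) (cong (∑ (h a) f +_) (∑-concatMap h as f))

∑-zero : (as : List A) → ∑ as (λ _ → 0ℚ) ≡ 0ℚ
∑-zero []       = refl
∑-zero (a ∷ as) = trans (+-identityˡ _) (∑-zero as)

∑-+ : ∀ as (f g : A → ℚ) → ∑ as (λ a → f a + g a) ≡ ∑ as f + ∑ as g
∑-+ []       f g = sym (+-identityˡ 0ℚ)
∑-+ (a ∷ as) f g = trans (cong (f a + g a +_) (∑-+ as f g)) (interchange (f a) (g a) (∑ as f) (∑ as g))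

∑-*ˡ : ∀ c as (f : A → ℚ) → ∑ as (λ a → c * f a) ≡ c * ∑ as f
∑-*ˡ c []       f = sym (*-zeroʳ c)
∑-*ˡ c (a ∷ as) f = trans (cong (c * f a +_) (∑-*ˡ c as f)) (sym (*-distribˡ-+ c _ _))

∑-swap : ∀ as bs (F : A → B → ℚ) → ∑ as (λ a → ∑ bs (F a)) ≡ ∑ bs (λ b → ∑ as (λ a → F a b))
∑-swap []       bs F = sym (∑-zero bs)
∑-swap (a ∷ as) bs F =
  trans (cong (∑ bs (F a) +_) (∑-swap as bs F)) (sym (∑-+ bs (F a) _))

-- Sums over antidiagonals: conv f n = ∑_{i+j=n} f i j

conv : (ℕ → ℕ → ℚ) → ℕ → ℚ
conv f zero    = f 0 0
conv f (suc n) = f 0 (suc n) + conv (λ i j → f (suc i) j) n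

conv-cong : ∀ {f g : ℕ → ℕ → ℚ} n → (∀ i j → f i j ≡ g i j) → conv f n ≡ conv g n
conv-cong zero    f≗g = f≗g 0 0
conv-cong (suc n) f≗g = cong₂ _+_ (f≗g 0 (suc n)) (conv-cong n (λ i → f≗g (suc i)))

conv-zero : ∀ n → conv (λ _ _ → 0ℚ) n ≡ 0ℚ
conv-zero zero    = refl
conv-zero (suc n) = trans (+-identityˡ _) (conv-zero n)

conv-+ : ∀ f g n → conv (λ i j → f i j + g i j) n ≡ conv f n + conv g n
conv-+ f g zero    = refl
conv-+ f g (suc n) =
  trans (cong (f 0 (suc n) + g 0 (suc n) +_) (conv-+ (λ i → f (suc i)) (λ i → g (suc i)) n))
        (interchange (f 0 (suc n)) (g 0 (suc n)) _ _)

conv-*ˡ : ∀ c f n → conv (λ i j → c * f i j) n ≡ c * conv f n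
conv-*ˡ c f zero    = refl
conv-*ˡ c f (suc n) =
  trans (cong (c * f 0 (suc n) +_) (conv-*ˡ c (λ i → f (suc i)) n))
        (sym (*-distribˡ-+ c (f 0 (suc n)) _))

conv-*ʳ : ∀ c f n → conv (λ i j → f i j * c) n ≡ conv f n * c
conv-*ʳ c f n = trans (conv-cong n (λ i j → *-comm (f i j) c)) (trans (conv-*ˡ c f n) (*-comm c _))

∑-conv : ∀ as (F : A → ℕ → ℕ → ℚ) n →
         ∑ as (λ a → conv (F a) n) ≡ conv (λ i j → ∑ as (λ a → F a i j)) n
∑-conv []       F n = sym (conv-zero n)
∑-conv (a ∷ as) F n = trans (cong (conv (F a) n +_) (∑-conv as F n)) (sym (conv-+ (F a) _ n))

conv-leftmost : ∀ f n → (∀ i j → f (suc i) j ≡ 0ℚ) → conv f n ≡ f 0 n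
conv-leftmost f zero    _     = refl
conv-leftmost f (suc n) f≡0 =
  trans (cong (f 0 (suc n) +_) (trans (conv-cong n f≡0) (conv-zero n))) (+-identityʳ _)

conv-snoc : ∀ f n → conv f (suc n) ≡ conv (λ i j → f i (suc j)) n + f (suc n) 0
conv-snoc f zero    = refl
conv-snoc f (suc n) =
  trans (cong (f 0 (suc (suc n)) +_) (conv-snoc (λ i → f (suc i)) n))
        (sym (+-assoc (f 0 (suc (suc n))) _ _))

conv-comm : ∀ f n → conv f n ≡ conv (flip f) n
conv-comm f zero    = refl
conv-comm f (suc n) = begin
  f 0 (suc n) + conv (λ i j → f (suc i) j) n  ≡⟨ cong (f 0 (suc n) +_) (conv-comm (λ i → f (suc i)) n) ⟩
  f 0 (suc n) + conv (λ i j → f (suc j) i) n  ≡⟨ +-comm (f 0 (suc n)) _ ⟩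
  conv (λ i j → f (suc j) i) n + f 0 (suc n)  ≡⟨ conv-snoc (flip f) n ⟨
  conv (flip f) (suc n)                       ∎

conv-assoc : ∀ (f : ℕ → ℕ → ℕ → ℚ) n →
             conv (λ i j → conv (λ a b → f a b j) i) n ≡ conv (λ a s → conv (λ b j → f a b j) s) n
conv-assoc f zero    = refl
conv-assoc f (suc n) = begin
  f 0 0 (suc n) + conv (λ i j → f 0 (suc i) j + conv (λ a b → f (suc a) b j) i) n
    ≡⟨ cong (f 0 0 (suc n) +_) (conv-+ (λ i j → f 0 (suc i) j) _ n) ⟩
  f 0 0 (suc n) + (conv (λ i j → f 0 (suc i) j) n + conv (λ i j → conv (λ a b → f (suc a) b j) i) n)
    ≡⟨ cong (λ t → f 0 0 (suc n) + (conv (λ i j → f 0 (suc i) j) n + t))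
            (conv-assoc (λ a → f (suc a)) n) ⟩
  f 0 0 (suc n) + (conv (λ i j → f 0 (suc i) j) n + conv (λ a s → conv (λ b j → f (suc a) b j) s) n)
    ≡⟨ +-assoc (f 0 0 (suc n)) _ _ ⟨
  f 0 0 (suc n) + conv (λ i j → f 0 (suc i) j) n + conv (λ a s → conv (λ b j → f (suc a) b j) s) n
    ∎

conv-reindex : ∀ (F : ℕ → ℕ → ℕ → ℚ) m → conv (λ a b → F a b (a ℕ.+ b)) m ≡ conv (λ a b → F a b m) m
conv-reindex F zero    = refl
conv-reindex F (suc m) = cong (F 0 (suc m) (suc m) +_) (conv-reindex (λ a b t → F (suc a) b (suc t)) m)

∑-upTo-conv : ∀ f n → ∑ (upTo (suc n)) (λ i → f i (n ∸ i)) ≡ conv f n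
∑-upTo-conv f zero    = +-identityʳ (f 0 0)
∑-upTo-conv f (suc n) = cong (f 0 (suc n) +_) (begin
  ∑ (applyUpTo suc (suc n)) summand   ≡⟨ cong (λ is → ∑ is summand) (map-upTo suc (suc n)) ⟨
  ∑ (map suc (upTo (suc n))) summand  ≡⟨ ∑-map suc (upTo (suc n)) summand ⟩
  ∑ (upTo (suc n)) (summand ∘ suc)    ≡⟨ ∑-upTo-conv (λ i → f (suc i)) n ⟩
  conv (λ i → f (suc i)) n            ∎)
  where
  summand : ℕ → ℚ
  summand i = f i (suc n ∸ i)

_⊛_ : (ℕ → ℚ) → (ℕ → ℚ) → ℕ → ℚ
x ⊛ y = conv (λ a b → x a * y b)

conv-⊛ : ∀ x y (Z : ℕ → ℕ → ℚ) n →
         conv (λ a s → x a * conv (λ b t → y b * Z (a ℕ.+ b) t) s) n ≡ conv (λ m t → (x ⊛ y) m * Z m t) n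
conv-⊛ x y Z n = begin
  conv (λ a s → x a * conv (λ b t → y b * Z (a ℕ.+ b) t) s) n
    ≡⟨ conv-cong n (λ a s → conv-*ˡ (x a) _ s) ⟨
  conv (λ a s → conv (λ b t → x a * (y b * Z (a ℕ.+ b) t)) s) n
    ≡⟨ conv-assoc (λ a b t → x a * (y b * Z (a ℕ.+ b) t)) n ⟨
  conv (λ m t → conv (λ a b → x a * (y b * Z (a ℕ.+ b) t)) m) n
    ≡⟨ conv-cong n (λ m t → conv-reindex (λ a b k → x a * (y b * Z k t)) m) ⟩
  conv (λ m t → conv (λ a b → x a * (y b * Z m t)) m) n
    ≡⟨ conv-cong n (λ m t → trans (conv-cong m (λ a b → sym (*-assoc (x a) (y b) _)))
                                  (conv-*ʳ (Z m t) (λ a b → x a * y b) m)) ⟩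
  conv (λ m t → (x ⊛ y) m * Z m t) n
    ∎

-- The coefficient of tᵃ in (1 - t)⁻ᵏ; truncated subtraction makes this right for k = 0 as well.
multichoose : ℕ → ℕ → ℚ
multichoose k a = ℕtoℚ ((k ℕ.+ a ∸ 1) C a)

multichoose-zero-suc : ∀ a → multichoose 0 (suc a) ≡ 0ℚ
multichoose-zero-suc a = cong ℕtoℚ (k>n⇒nCk≡0 (ℕₚ.n<1+n a))

multichoose-pascal : ∀ k a → multichoose (suc k) (suc a) ≡ multichoose (suc k) a + multichoose k (suc a)
multichoose-pascal k a = begin
  ℕtoℚ ((k ℕ.+ suc a) C suc a)                  ≡⟨ cong (λ t → ℕtoℚ (t C suc a)) (ℕₚ.+-suc k a) ⟩
  ℕtoℚ (suc (k ℕ.+ a) C suc a)                  ≡⟨ cong ℕtoℚ (nCk+nC[k+1]≡[n+1]C[k+1] (k ℕ.+ a) a) ⟨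
  ℕtoℚ ((k ℕ.+ a) C a ℕ.+ (k ℕ.+ a) C suc a)    ≡⟨ ℕtoℚ-+ ((k ℕ.+ a) C a) _ ⟩
  multichoose (suc k) a + ℕtoℚ ((k ℕ.+ a) C suc a)
    ≡⟨ cong (λ t → multichoose (suc k) a + ℕtoℚ ((t ∸ 1) C suc a)) (ℕₚ.+-suc k a) ⟨
  multichoose (suc k) a + multichoose k (suc a) ∎

multichoose-vandermonde : ∀ k l m → (multichoose k ⊛ multichoose l) m ≡ multichoose (k ℕ.+ l) m
multichoose-vandermonde zero l m =
  trans (conv-leftmost (λ a b → multichoose 0 a * multichoose l b) m
           (λ a b → trans (cong (_* multichoose l b) (multichoose-zero-suc a)) (*-zeroˡ (multichoose l b))))
        (*-identityˡ (multichoose l m))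
multichoose-vandermonde (suc k) l zero    = refl
multichoose-vandermonde (suc k) l (suc m) = begin
  1ℚ * multichoose l (suc m) + conv (λ a b → multichoose (suc k) (suc a) * multichoose l b) m
    ≡⟨ cong (1ℚ * multichoose l (suc m) +_) (conv-cong m (λ a b →
         trans (cong (_* multichoose l b) (multichoose-pascal k a))
               (*-distribʳ-+ (multichoose l b) (multichoose (suc k) a) (multichoose k (suc a))))) ⟩
  1ℚ * multichoose l (suc m) + conv (λ a b → multichoose (suc k) a * multichoose l b
                                            + multichoose k (suc a) * multichoose l b) m
    ≡⟨ cong (1ℚ * multichoose l (suc m) +_)
            (conv-+ (λ a b → multichoose (suc k) a * multichoose l b) _ m) ⟩
  1ℚ * multichoose l (suc m) + ((multichoose (suc k) ⊛ multichoose l) m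
                               + conv (λ a b → multichoose k (suc a) * multichoose l b) m)
    ≡⟨ x+[y+z]≡y+[x+z] (1ℚ * multichoose l (suc m)) ((multichoose (suc k) ⊛ multichoose l) m) _ ⟩
  (multichoose (suc k) ⊛ multichoose l) m + (multichoose k ⊛ multichoose l) (suc m)
    ≡⟨ cong₂ _+_ (multichoose-vandermonde (suc k) l m) (multichoose-vandermonde k l (suc m)) ⟩
  multichoose (suc k ℕ.+ l) m + multichoose (k ℕ.+ l) (suc m)
    ≡⟨ multichoose-pascal (k ℕ.+ l) m ⟨
  multichoose (suc k ℕ.+ l) (suc m) ∎

⟨_∣_⟩ : (Index → ℚ) → Lin → ℚ
⟨ g ∣ x ⟩ = ∑ x (λ (c , k) → c * g k)

⟨_∣_⊗_⟩ : (Index → Index → ℚ) → Lin → Lin → ℚ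
⟨ F ∣ x ⊗ y ⟩ = ⟨ (λ p → ⟨ F p ∣ y ⟩) ∣ x ⟩

_≐_ : Lin → Lin → Set
x ≐ y = ∀ g → ⟨ g ∣ x ⟩ ≡ ⟨ g ∣ y ⟩

infix 4 _≐_

⟨∣⟩-cong : ∀ {f g : Index → ℚ} x → (∀ k → f k ≡ g k) → ⟨ f ∣ x ⟩ ≡ ⟨ g ∣ x ⟩
⟨∣⟩-cong x f≗g = ∑-cong x (λ (c , k) → cong (c *_) (f≗g k))

⟨∣⟩-+ : ∀ f g x → ⟨ (λ k → f k + g k) ∣ x ⟩ ≡ ⟨ f ∣ x ⟩ + ⟨ g ∣ x ⟩
⟨∣⟩-+ f g x = trans (∑-cong x (λ (c , k) → *-distribˡ-+ c (f k) (g k))) (∑-+ x _ _)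

⟨∣⟩-*ˡ : ∀ c f x → ⟨ (λ k → c * f k) ∣ x ⟩ ≡ c * ⟨ f ∣ x ⟩
⟨∣⟩-*ˡ c f x = trans (∑-cong x (λ (d , k) → x*[y*z]≡y*[x*z] d c (f k))) (∑-*ˡ c x _)

⟨∣⟩-conv : ∀ (F : ℕ → ℕ → Index → ℚ) n x →
           ⟨ (λ k → conv (λ i j → F i j k) n) ∣ x ⟩ ≡ conv (λ i j → ⟨ F i j ∣ x ⟩) n
⟨∣⟩-conv F n x = trans (∑-cong x (λ (c , k) → sym (conv-*ˡ c (λ i j → F i j k) n))) (∑-conv x _ n)

⟨∣basis⟩ : ∀ g k → ⟨ g ∣ basis k ⟩ ≡ g k
⟨∣basis⟩ g k = trans (+-identityʳ _) (*-identityˡ (g k))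

⟨∣⊕⟩ : ∀ g x y → ⟨ g ∣ x ⊕ y ⟩ ≡ ⟨ g ∣ x ⟩ + ⟨ g ∣ y ⟩
⟨∣⊕⟩ g x y = ∑-++ x y _

⟨∣map₂⟩ : ∀ g φ x → ⟨ g ∣ map (map₂ φ) x ⟩ ≡ ⟨ g ∘ φ ∣ x ⟩
⟨∣map₂⟩ g φ x = ∑-map (map₂ φ) x _

⟨∣map-scale⟩ : ∀ g c φ x → ⟨ g ∣ map (Product.map (c *_) φ) x ⟩ ≡ c * ⟨ g ∘ φ ∣ x ⟩
⟨∣map-scale⟩ g c φ x =
  trans (∑-map _ x _) (trans (∑-cong x (λ (d , k) → *-assoc c d (g (φ k)))) (∑-*ˡ c x _))

⟨∣scale⟩ : ∀ g c x → ⟨ g ∣ scale c x ⟩ ≡ c * ⟨ g ∣ x ⟩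
⟨∣scale⟩ g c = ⟨∣map-scale⟩ g c id

⟨∣linExt⟩ : ∀ g f x → ⟨ g ∣ linExt f x ⟩ ≡ ⟨ (λ k → ⟨ g ∣ f k ⟩) ∣ x ⟩
⟨∣linExt⟩ g f x = trans (∑-concatMap _ x _) (∑-cong x (λ (c , k) → ⟨∣scale⟩ g c (f k)))

⟨∣bilinExt⟩ : ∀ g f x y → ⟨ g ∣ bilinExt f x y ⟩ ≡ ⟨ (λ k l → ⟨ g ∣ f k l ⟩) ∣ x ⊗ y ⟩
⟨∣bilinExt⟩ g f x y = trans (∑-concatMap _ x _) (∑-cong x (λ (c , k) → begin
  ∑ (concatMap (λ (d , l) → scale (c * d) (f k l)) y) _  ≡⟨ ∑-concatMap _ y _ ⟩
  ∑ y (λ (d , l) → ⟨ g ∣ scale (c * d) (f k l) ⟩)        ≡⟨ ∑-cong y (λ (d , l) →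
                                                              trans (⟨∣scale⟩ g (c * d) (f k l)) (*-assoc c d _)) ⟩
  ∑ y (λ (d , l) → c * (d * ⟨ g ∣ f k l ⟩))              ≡⟨ ∑-*ˡ c y _ ⟩
  c * ⟨ (λ l → ⟨ g ∣ f k l ⟩) ∣ y ⟩                      ∎))

⟨∣⊗⟩-swap : ∀ F x y → ⟨ F ∣ x ⊗ y ⟩ ≡ ⟨ flip F ∣ y ⊗ x ⟩
⟨∣⊗⟩-swap F x y = begin
  ∑ x (λ (c , p) → c * ∑ y (λ (d , q) → d * F p q))      ≡⟨ ∑-cong x (λ (c , p) → ∑-*ˡ c y _) ⟨
  ∑ x (λ (c , p) → ∑ y (λ (d , q) → c * (d * F p q)))    ≡⟨ ∑-swap x y _ ⟩
  ∑ y (λ (d , q) → ∑ x (λ (c , p) → c * (d * F p q)))    ≡⟨ ∑-cong y (λ (d , q) →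
                                                              ∑-cong x (λ (c , p) → x*[y*z]≡y*[x*z] c d (F p q))) ⟩
  ∑ y (λ (d , q) → ∑ x (λ (c , p) → d * (c * F p q)))    ≡⟨ ∑-cong y (λ (d , q) → ∑-*ˡ d x _) ⟩
  ∑ y (λ (d , q) → d * ∑ x (λ (c , p) → c * F p q))      ∎

coeff≡⟨δ∣⟩ : ∀ x w → coeff x w ≡ ⟨ (λ k → coeff (basis k) w) ∣ x ⟩
coeff≡⟨δ∣⟩ []            w = refl
coeff≡⟨δ∣⟩ ((c , k) ∷ x) w with ≡-dec ℕ._≟_ k w
... | yes _ = cong₂ _+_ (sym (trans (cong (c *_) (+-identityʳ 1ℚ)) (*-identityʳ c))) (coeff≡⟨δ∣⟩ x w)
... | no  _ = trans (coeff≡⟨δ∣⟩ x w) (sym (trans (cong (_+ _) (*-zeroʳ c)) (+-identityˡ _)))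

≐⇒≈ : ∀ {x y} → x ≐ y → x ≈ y
≐⇒≈ {x} {y} x≐y w =
  trans (coeff≡⟨δ∣⟩ x w) (trans (x≐y (λ k → coeff (basis k) w)) (sym (coeff≡⟨δ∣⟩ y w)))

-- σ is multiplicative

σᵀ : ℕ → (Index → ℚ) → Index → ℚ
σᵀ n g z = ⟨ g ∣ σIdx n z ⟩

σIdx-cons : ∀ n k z →
            σIdx n (k ∷ z) ≡ concatMap (λ a → map (Product.map (multichoose k a *_) ((k ℕ.+ a) ∷_))
                                                  (σIdx (n ∸ a) z))
                                       (upTo (suc n))
σIdx-cons zero    k z = refl
σIdx-cons (suc n) k z = refl

σᵀ-cons : ∀ n g k z → σᵀ n g (k ∷ z) ≡ conv (λ a j → multichoose k a * σᵀ j (g ∘ ((k ℕ.+ a) ∷_)) z) n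
σᵀ-cons n g k z = begin
  ⟨ g ∣ σIdx n (k ∷ z) ⟩
    ≡⟨ cong ⟨ g ∣_⟩ (σIdx-cons n k z) ⟩
  ⟨ g ∣ concatMap block (upTo (suc n)) ⟩
    ≡⟨ ∑-concatMap block (upTo (suc n)) (λ (c , w) → c * g w) ⟩
  ∑ (upTo (suc n)) (λ a → ⟨ g ∣ block a ⟩)
    ≡⟨ ∑-cong (upTo (suc n)) (λ a → ⟨∣map-scale⟩ g (multichoose k a) ((k ℕ.+ a) ∷_) (σIdx (n ∸ a) z)) ⟩
  ∑ (upTo (suc n)) (λ a → multichoose k a * σᵀ (n ∸ a) (g ∘ ((k ℕ.+ a) ∷_)) z)
    ≡⟨ ∑-upTo-conv (λ a j → multichoose k a * σᵀ j (g ∘ ((k ℕ.+ a) ∷_)) z) n ⟩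
  conv (λ a j → multichoose k a * σᵀ j (g ∘ ((k ℕ.+ a) ∷_)) z) n
    ∎
  where
  block : ℕ → Lin
  block a = map (Product.map (multichoose k a *_) ((k ℕ.+ a) ∷_)) (σIdx (n ∸ a) z)

σᵀ-zero : ∀ g z → σᵀ 0 g z ≡ g z
σᵀ-zero g []      = ⟨∣basis⟩ g []
σᵀ-zero g (k ∷ z) = begin
  σᵀ 0 g (k ∷ z)                      ≡⟨ σᵀ-cons 0 g k z ⟩
  1ℚ * σᵀ 0 (g ∘ ((k ℕ.+ 0) ∷_)) z    ≡⟨ *-identityˡ _ ⟩
  σᵀ 0 (g ∘ ((k ℕ.+ 0) ∷_)) z         ≡⟨ σᵀ-zero (g ∘ ((k ℕ.+ 0) ∷_)) z ⟩
  g ((k ℕ.+ 0) ∷ z)                   ≡⟨ cong (λ t → g (t ∷ z)) (ℕₚ.+-identityʳ k) ⟩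
  g (k ∷ z)                           ∎

σ⊗ᵀ : ℕ → (Index → Index → ℚ) → Index → Index → ℚ
σ⊗ᵀ n F u v = conv (λ i j → ⟨ F ∣ σIdx i u ⊗ σIdx j v ⟩) n

σ⊗ᵀ-cong : ∀ n {F G : Index → Index → ℚ} u v → (∀ p q → F p q ≡ G p q) →
           σ⊗ᵀ n F u v ≡ σ⊗ᵀ n G u v
σ⊗ᵀ-cong n u v F≗G = conv-cong n (λ i j → ⟨∣⟩-cong (σIdx i u) (λ p → ⟨∣⟩-cong (σIdx j v) (F≗G p)))

σ⊗ᵀ-+ : ∀ n F G u v → σ⊗ᵀ n (λ p q → F p q + G p q) u v ≡ σ⊗ᵀ n F u v + σ⊗ᵀ n G u v
σ⊗ᵀ-+ n F G u v = trans
  (conv-cong n (λ i j → trans (⟨∣⟩-cong (σIdx i u) (λ p → ⟨∣⟩-+ (F p) (G p) (σIdx j v)))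
                              (⟨∣⟩-+ _ _ (σIdx i u))))
  (conv-+ _ _ n)

σ⊗ᵀ-swap : ∀ n F u v → σ⊗ᵀ n F u v ≡ σ⊗ᵀ n (flip F) v u
σ⊗ᵀ-swap n F u v = trans (conv-comm _ n) (conv-cong n (λ i j → ⟨∣⊗⟩-swap F (σIdx j u) (σIdx i v)))

σ⊗ᵀ-nilˡ : ∀ n F v → σ⊗ᵀ n F [] v ≡ σᵀ n (F []) v
σ⊗ᵀ-nilˡ n F v = trans (conv-leftmost _ n (λ i j → refl)) (⟨∣basis⟩ (λ p → σᵀ n (F p) v) [])

σ⊗ᵀ-nilʳ : ∀ n F u → σ⊗ᵀ n F u [] ≡ σᵀ n (λ p → F p []) u
σ⊗ᵀ-nilʳ n F u = trans (σ⊗ᵀ-swap n F u []) (σ⊗ᵀ-nilˡ n (flip F) u)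

σ⊗ᵀ-consˡ : ∀ n F k u v →
            σ⊗ᵀ n F (k ∷ u) v ≡ conv (λ a s → multichoose k a * σ⊗ᵀ s (F ∘ ((k ℕ.+ a) ∷_)) u v) n
σ⊗ᵀ-consˡ n F k u v = begin
  conv (λ i j → σᵀ i (λ p → σᵀ j (F p) v) (k ∷ u)) n
    ≡⟨ conv-cong n (λ i j → σᵀ-cons i _ k u) ⟩
  conv (λ i j → conv (λ a b → multichoose k a * σᵀ b (λ p → σᵀ j (F ((k ℕ.+ a) ∷ p)) v) u) i) n
    ≡⟨ conv-assoc (λ a b j → multichoose k a * σᵀ b (λ p → σᵀ j (F ((k ℕ.+ a) ∷ p)) v) u) n ⟩
  conv (λ a s → conv (λ b j → multichoose k a * σᵀ b (λ p → σᵀ j (F ((k ℕ.+ a) ∷ p)) v) u) s) n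
    ≡⟨ conv-cong n (λ a s → conv-*ˡ (multichoose k a) _ s) ⟩
  conv (λ a s → multichoose k a * σ⊗ᵀ s (F ∘ ((k ℕ.+ a) ∷_)) u v) n
    ∎

σ⊗ᵀ-consʳ : ∀ n F u l v →
            σ⊗ᵀ n F u (l ∷ v) ≡ conv (λ a s → multichoose l a * σ⊗ᵀ s (λ p q → F p ((l ℕ.+ a) ∷ q)) u v) n
σ⊗ᵀ-consʳ n F u l v = begin
  σ⊗ᵀ n F u (l ∷ v)
    ≡⟨ σ⊗ᵀ-swap n F u (l ∷ v) ⟩
  σ⊗ᵀ n (flip F) (l ∷ v) u
    ≡⟨ σ⊗ᵀ-consˡ n (flip F) l v u ⟩
  conv (λ a s → multichoose l a * σ⊗ᵀ s (flip F ∘ ((l ℕ.+ a) ∷_)) v u) n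
    ≡⟨ conv-cong n (λ a s → cong (multichoose l a *_) (σ⊗ᵀ-swap s _ u v)) ⟨
  conv (λ a s → multichoose l a * σ⊗ᵀ s (λ p q → F p ((l ℕ.+ a) ∷ q)) u v) n
    ∎

σ⊗ᵀ-cons-cons : ∀ n F k u l v → σ⊗ᵀ n F (k ∷ u) (l ∷ v) ≡
  conv (λ a s → multichoose k a * conv (λ b t → multichoose l b *
                                         σ⊗ᵀ t (λ p q → F ((k ℕ.+ a) ∷ p) ((l ℕ.+ b) ∷ q)) u v) s) n
σ⊗ᵀ-cons-cons n F k u l v =
  trans (σ⊗ᵀ-consˡ n F k u (l ∷ v)) (conv-cong n (λ a s → cong (multichoose k a *_) (σ⊗ᵀ-consʳ s _ u l v)))

σ⊗ᵀ-cong-∷ : ∀ n {F G : Index → Index → ℚ} k u l v →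
             (∀ x p y q → F (x ∷ p) (y ∷ q) ≡ G (x ∷ p) (y ∷ q)) →
             σ⊗ᵀ n F (k ∷ u) (l ∷ v) ≡ σ⊗ᵀ n G (k ∷ u) (l ∷ v)
σ⊗ᵀ-cong-∷ n {F} {G} k u l v F≗G =
  trans (σ⊗ᵀ-cons-cons n F k u l v)
        (trans (conv-cong n (λ a s → cong (multichoose k a *_) (conv-cong s (λ b t →
                  cong (multichoose l b *_) (σ⊗ᵀ-cong t u v (λ p q → F≗G _ p _ q))))))
               (sym (σ⊗ᵀ-cons-cons n G k u l v)))

σ⊗ᵀ-merge : ∀ n F (H : ℕ → Index → Index → ℚ) k u l v →
            (∀ x p y q → F (x ∷ p) (y ∷ q) ≡ H (x ℕ.+ y) p q) →
            σ⊗ᵀ n F (k ∷ u) (l ∷ v) ≡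
            conv (λ m s → multichoose (k ℕ.+ l) m * σ⊗ᵀ s (H (k ℕ.+ l ℕ.+ m)) u v) n
σ⊗ᵀ-merge n F H k u l v F≡H = begin
  σ⊗ᵀ n F (k ∷ u) (l ∷ v)
    ≡⟨ σ⊗ᵀ-cons-cons n F k u l v ⟩
  conv (λ a s → multichoose k a * conv (λ b t → multichoose l b *
                                         σ⊗ᵀ t (λ p q → F ((k ℕ.+ a) ∷ p) ((l ℕ.+ b) ∷ q)) u v) s) n
    ≡⟨ conv-cong n (λ a s → cong (multichoose k a *_) (conv-cong s (λ b t →
         cong (multichoose l b *_) (σ⊗ᵀ-cong t u v (λ p q →
           trans (F≡H _ p _ q) (cong (λ x → H x p q) (ℕ-+-interchange k a l b))))))) ⟩
  conv (λ a s → multichoose k a * conv (λ b t → multichoose l b * Z (a ℕ.+ b) t) s) n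
    ≡⟨ conv-⊛ (multichoose k) (multichoose l) Z n ⟩
  conv (λ m t → (multichoose k ⊛ multichoose l) m * Z m t) n
    ≡⟨ conv-cong n (λ m t → cong (_* Z m t) (multichoose-vandermonde k l m)) ⟩
  conv (λ m t → multichoose (k ℕ.+ l) m * Z m t) n
    ∎
  where
  Z : ℕ → ℕ → ℚ
  Z m t = σ⊗ᵀ t (H (k ℕ.+ l ℕ.+ m)) u v

harmRevᵀ : (Index → ℚ) → Index → Index → ℚ
harmRevᵀ g u v = ⟨ g ∣ harmRev u v ⟩

harmRevᵀ-nilʳ : ∀ g u → harmRevᵀ g u [] ≡ g u
harmRevᵀ-nilʳ g []      = ⟨∣basis⟩ g []
harmRevᵀ-nilʳ g (k ∷ u) = ⟨∣basis⟩ g (k ∷ u)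

harmRevᵀ-∷ : ∀ g k u l v → harmRevᵀ g (k ∷ u) (l ∷ v) ≡
             harmRevᵀ (g ∘ (k ∷_)) u (l ∷ v) + harmRevᵀ (g ∘ (l ∷_)) (k ∷ u) v
               + harmRevᵀ (g ∘ ((k ℕ.+ l) ∷_)) u v
harmRevᵀ-∷ g k u l v = begin
  ⟨ g ∣ xₖ ⊕ xₗ ⊕ xₖₗ ⟩
    ≡⟨ ⟨∣⊕⟩ g (xₖ ⊕ xₗ) xₖₗ ⟩
  ⟨ g ∣ xₖ ⊕ xₗ ⟩ + ⟨ g ∣ xₖₗ ⟩
    ≡⟨ cong (_+ ⟨ g ∣ xₖₗ ⟩) (⟨∣⊕⟩ g xₖ xₗ) ⟩
  ⟨ g ∣ xₖ ⟩ + ⟨ g ∣ xₗ ⟩ + ⟨ g ∣ xₖₗ ⟩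
    ≡⟨ cong₂ _+_ (cong₂ _+_ (⟨∣map₂⟩ g (k ∷_) (harmRev u (l ∷ v))) (⟨∣map₂⟩ g (l ∷_) (harmRev (k ∷ u) v)))
                 (⟨∣map₂⟩ g ((k ℕ.+ l) ∷_) (harmRev u v)) ⟩
  harmRevᵀ (g ∘ (k ∷_)) u (l ∷ v) + harmRevᵀ (g ∘ (l ∷_)) (k ∷ u) v
    + harmRevᵀ (g ∘ ((k ℕ.+ l) ∷_)) u v ∎
  where
  xₖ xₗ xₖₗ : Lin
  xₖ = map (map₂ (k ∷_)) (harmRev u (l ∷ v))
  xₗ = map (map₂ (l ∷_)) (harmRev (k ∷ u) v)
  xₖₗ = map (map₂ ((k ℕ.+ l) ∷_)) (harmRev u v)

σᵀ-harmRev : ∀ u v n g → harmRevᵀ (σᵀ n g) u v ≡ σ⊗ᵀ n (harmRevᵀ g) u v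
σᵀ-harmRev [] v n g = begin
  harmRevᵀ (σᵀ n g) [] v    ≡⟨ ⟨∣basis⟩ (σᵀ n g) v ⟩
  σᵀ n g v                  ≡⟨ ⟨∣⟩-cong (σIdx n v) (⟨∣basis⟩ g) ⟨
  σᵀ n (harmRevᵀ g []) v    ≡⟨ σ⊗ᵀ-nilˡ n (harmRevᵀ g) v ⟨
  σ⊗ᵀ n (harmRevᵀ g) [] v   ∎
σᵀ-harmRev (k ∷ u) [] n g = begin
  harmRevᵀ (σᵀ n g) (k ∷ u) []            ≡⟨ ⟨∣basis⟩ (σᵀ n g) (k ∷ u) ⟩
  σᵀ n g (k ∷ u)                          ≡⟨ ⟨∣⟩-cong (σIdx n (k ∷ u)) (harmRevᵀ-nilʳ g) ⟨
  σᵀ n (λ p → harmRevᵀ g p []) (k ∷ u)    ≡⟨ σ⊗ᵀ-nilʳ n (harmRevᵀ g) (k ∷ u) ⟨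
  σ⊗ᵀ n (harmRevᵀ g) (k ∷ u) []           ∎
σᵀ-harmRev (k ∷ u) (l ∷ v) n g = begin
  harmRevᵀ (σᵀ n g) (k ∷ u) (l ∷ v)
    ≡⟨ harmRevᵀ-∷ (σᵀ n g) k u l v ⟩
  harmRevᵀ (σᵀ n g ∘ (k ∷_)) u (l ∷ v) + harmRevᵀ (σᵀ n g ∘ (l ∷_)) (k ∷ u) v
    + harmRevᵀ (σᵀ n g ∘ ((k ℕ.+ l) ∷_)) u v
    ≡⟨ cong₂ _+_ (cong₂ _+_ (expand-head k u (l ∷ v) (σᵀ-harmRev u (l ∷ v)))
                            (expand-head l (k ∷ u) v (σᵀ-harmRev (k ∷ u) v)))
                 (expand-head (k ℕ.+ l) u v (σᵀ-harmRev u v)) ⟩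
  conv (λ a s → multichoose k a * σ⊗ᵀ s (t₁ ∘ ((k ℕ.+ a) ∷_)) u (l ∷ v)) n
    + conv (λ a s → multichoose l a * σ⊗ᵀ s (λ p q → t₂ p ((l ℕ.+ a) ∷ q)) (k ∷ u) v) n
    + conv (λ m s → multichoose (k ℕ.+ l) m * σ⊗ᵀ s (H (k ℕ.+ l ℕ.+ m)) u v) n
    ≡⟨ cong₂ _+_ (cong₂ _+_ (σ⊗ᵀ-consˡ n t₁ k u (l ∷ v)) (σ⊗ᵀ-consʳ n t₂ (k ∷ u) l v))
                 (σ⊗ᵀ-merge n t₃ H k u l v (λ _ _ _ _ → refl)) ⟨
  σ⊗ᵀ n t₁ (k ∷ u) (l ∷ v) + σ⊗ᵀ n t₂ (k ∷ u) (l ∷ v) + σ⊗ᵀ n t₃ (k ∷ u) (l ∷ v)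
    ≡⟨ cong (_+ σ⊗ᵀ n t₃ (k ∷ u) (l ∷ v)) (σ⊗ᵀ-+ n t₁ t₂ (k ∷ u) (l ∷ v)) ⟨
  σ⊗ᵀ n (λ p q → t₁ p q + t₂ p q) (k ∷ u) (l ∷ v) + σ⊗ᵀ n t₃ (k ∷ u) (l ∷ v)
    ≡⟨ σ⊗ᵀ-+ n (λ p q → t₁ p q + t₂ p q) t₃ (k ∷ u) (l ∷ v) ⟨
  σ⊗ᵀ n (λ p q → t₁ p q + t₂ p q + t₃ p q) (k ∷ u) (l ∷ v)
    ≡⟨ σ⊗ᵀ-cong-∷ n k u l v (λ x p y q → sym (harmRevᵀ-∷ g x p y q)) ⟩
  σ⊗ᵀ n (harmRevᵀ g) (k ∷ u) (l ∷ v)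
    ∎
  where
  expand-head : ∀ m U V → (∀ j g → harmRevᵀ (σᵀ j g) U V ≡ σ⊗ᵀ j (harmRevᵀ g) U V) →
                harmRevᵀ (σᵀ n g ∘ (m ∷_)) U V ≡
                conv (λ a j → multichoose m a * σ⊗ᵀ j (harmRevᵀ (g ∘ ((m ℕ.+ a) ∷_))) U V) n
  expand-head m U V ih = begin
    ⟨ σᵀ n g ∘ (m ∷_) ∣ harmRev U V ⟩
      ≡⟨ ⟨∣⟩-cong (harmRev U V) (σᵀ-cons n g m) ⟩
    ⟨ (λ z → conv (λ a j → multichoose m a * σᵀ j (g ∘ ((m ℕ.+ a) ∷_)) z) n) ∣ harmRev U V ⟩
      ≡⟨ ⟨∣⟩-conv (λ a j z → multichoose m a * σᵀ j (g ∘ ((m ℕ.+ a) ∷_)) z) n (harmRev U V) ⟩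
    conv (λ a j → ⟨ (λ z → multichoose m a * σᵀ j (g ∘ ((m ℕ.+ a) ∷_)) z) ∣ harmRev U V ⟩) n
      ≡⟨ conv-cong n (λ a j → trans (⟨∣⟩-*ˡ (multichoose m a) _ (harmRev U V))
                                    (cong (multichoose m a *_) (ih j (g ∘ ((m ℕ.+ a) ∷_))))) ⟩
    conv (λ a j → multichoose m a * σ⊗ᵀ j (harmRevᵀ (g ∘ ((m ℕ.+ a) ∷_))) U V) n
      ∎
  -- The three terms of harmRevᵀ g on nonempty indices (harmRevᵀ-∷); their values elsewhere are
  -- irrelevant by σ⊗ᵀ-cong-∷.
  t₁ t₂ t₃ : Index → Index → ℚ
  t₁ []      q = 0ℚ
  t₁ (x ∷ p) q = harmRevᵀ (g ∘ (x ∷_)) p q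
  t₂ p []      = 0ℚ
  t₂ p (y ∷ q) = harmRevᵀ (g ∘ (y ∷_)) p q
  t₃ (x ∷ p) (y ∷ q) = harmRevᵀ (g ∘ ((x ℕ.+ y) ∷_)) p q
  t₃ _       _       = 0ℚ
  H : ℕ → Index → Index → ℚ
  H x = harmRevᵀ (g ∘ (x ∷_))

-- σ commutes with reversal

σᵀ-++ : ∀ n g z₁ z₂ → σᵀ n g (z₁ ++ z₂) ≡ σ⊗ᵀ n (λ p q → g (p ++ q)) z₁ z₂
σᵀ-++ n g []       z₂ = sym (σ⊗ᵀ-nilˡ n (λ p q → g (p ++ q)) z₂)
σᵀ-++ n g (k ∷ z₁) z₂ = begin
  σᵀ n g (k ∷ z₁ ++ z₂)
    ≡⟨ σᵀ-cons n g k (z₁ ++ z₂) ⟩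
  conv (λ a j → multichoose k a * σᵀ j (g ∘ ((k ℕ.+ a) ∷_)) (z₁ ++ z₂)) n
    ≡⟨ conv-cong n (λ a j → cong (multichoose k a *_) (σᵀ-++ j (g ∘ ((k ℕ.+ a) ∷_)) z₁ z₂)) ⟩
  conv (λ a j → multichoose k a * σ⊗ᵀ j (λ p q → g ((k ℕ.+ a) ∷ p ++ q)) z₁ z₂) n
    ≡⟨ σ⊗ᵀ-consˡ n (λ p q → g (p ++ q)) k z₁ z₂ ⟨
  σ⊗ᵀ n (λ p q → g (p ++ q)) (k ∷ z₁) z₂
    ∎

σᵀ-reverse : ∀ n g z → σᵀ n g (reverse z) ≡ σᵀ n (g ∘ reverse) z
σᵀ-reverse zero    g [] = refl
σᵀ-reverse (suc n) g [] = refl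
σᵀ-reverse n g (k ∷ z) = begin
  σᵀ n g (reverse (k ∷ z))
    ≡⟨ cong (σᵀ n g) (unfold-reverse k z) ⟩
  σᵀ n g (reverse z ++ [ k ])
    ≡⟨ σᵀ-++ n g (reverse z) [ k ] ⟩
  σ⊗ᵀ n (λ p q → g (p ++ q)) (reverse z) [ k ]
    ≡⟨ σ⊗ᵀ-swap n (λ p q → g (p ++ q)) (reverse z) [ k ] ⟩
  σ⊗ᵀ n (λ q p → g (p ++ q)) [ k ] (reverse z)
    ≡⟨ σ⊗ᵀ-consˡ n (λ q p → g (p ++ q)) k [] (reverse z) ⟩
  conv (λ a s → multichoose k a * σ⊗ᵀ s (λ q p → g (p ++ (k ℕ.+ a) ∷ q)) [] (reverse z)) n
    ≡⟨ conv-cong n (λ a s → cong (multichoose k a *_) (begin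
         σ⊗ᵀ s (λ q p → g (p ++ (k ℕ.+ a) ∷ q)) [] (reverse z)  ≡⟨ σ⊗ᵀ-nilˡ s _ (reverse z) ⟩
         σᵀ s (λ p → g (p ++ [ k ℕ.+ a ])) (reverse z)          ≡⟨ σᵀ-reverse s _ z ⟩
         σᵀ s (λ p → g (reverse p ++ [ k ℕ.+ a ])) z            ≡⟨ ⟨∣⟩-cong (σIdx s z) (λ p →
                                                                     cong g (unfold-reverse (k ℕ.+ a) p)) ⟨
         σᵀ s (g ∘ reverse ∘ ((k ℕ.+ a) ∷_)) z                  ∎)) ⟩
  conv (λ a s → multichoose k a * σᵀ s (g ∘ reverse ∘ ((k ℕ.+ a) ∷_)) z) n
    ≡⟨ σᵀ-cons n (g ∘ reverse) k z ⟨
  σᵀ n (g ∘ reverse) (k ∷ z)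
    ∎

σ⊗ᵀ-reverse : ∀ n F u v →
              σ⊗ᵀ n F (reverse u) (reverse v) ≡ σ⊗ᵀ n (λ p q → F (reverse p) (reverse q)) u v
σ⊗ᵀ-reverse n F u v = conv-cong n (λ i j →
  trans (σᵀ-reverse i _ u) (⟨∣⟩-cong (σIdx i u) (λ p → σᵀ-reverse j (F (reverse p)) v)))

harmIdxᵀ : (Index → ℚ) → Index → Index → ℚ
harmIdxᵀ g u v = ⟨ g ∣ harmIdx u v ⟩

harmIdxᵀ≡harmRevᵀ : ∀ g u v → harmIdxᵀ g u v ≡ harmRevᵀ (g ∘ reverse) (reverse u) (reverse v)
harmIdxᵀ≡harmRevᵀ g u v = ⟨∣map₂⟩ g reverse (harmRev (reverse u) (reverse v))

σᵀ-harmIdx : ∀ n g u v → harmIdxᵀ (σᵀ n g) u v ≡ σ⊗ᵀ n (harmIdxᵀ g) u v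
σᵀ-harmIdx n g u v = begin
  harmIdxᵀ (σᵀ n g) u v
    ≡⟨ harmIdxᵀ≡harmRevᵀ (σᵀ n g) u v ⟩
  harmRevᵀ (σᵀ n g ∘ reverse) (reverse u) (reverse v)
    ≡⟨ ⟨∣⟩-cong (harmRev (reverse u) (reverse v)) (σᵀ-reverse n g) ⟩
  harmRevᵀ (σᵀ n (g ∘ reverse)) (reverse u) (reverse v)
    ≡⟨ σᵀ-harmRev (reverse u) (reverse v) n (g ∘ reverse) ⟩
  σ⊗ᵀ n (harmRevᵀ (g ∘ reverse)) (reverse u) (reverse v)
    ≡⟨ σ⊗ᵀ-reverse n (harmRevᵀ (g ∘ reverse)) u v ⟩
  σ⊗ᵀ n (λ p q → harmRevᵀ (g ∘ reverse) (reverse p) (reverse q)) u v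
    ≡⟨ σ⊗ᵀ-cong n u v (harmIdxᵀ≡harmRevᵀ g) ⟨
  σ⊗ᵀ n (harmIdxᵀ g) u v
    ∎

⟨∣σ-basis⟩ : ∀ f m u → ⟨ f ∣ σ m (basis u) ⟩ ≡ σᵀ m f u
⟨∣σ-basis⟩ f m u = trans (⟨∣linExt⟩ f (σIdx m) (basis u)) (⟨∣basis⟩ (σᵀ m f) u)

⟨∣σ⋆σ⟩ : ∀ g m m′ u v → ⟨ g ∣ σ m (basis u) ⋆ σ m′ (basis v) ⟩ ≡ ⟨ harmIdxᵀ g ∣ σIdx m u ⊗ σIdx m′ v ⟩
⟨∣σ⋆σ⟩ g m m′ u v = begin
  ⟨ g ∣ σ m (basis u) ⋆ σ m′ (basis v) ⟩
    ≡⟨ ⟨∣bilinExt⟩ g harmIdx (σ m (basis u)) (σ m′ (basis v)) ⟩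
  ⟨ harmIdxᵀ g ∣ σ m (basis u) ⊗ σ m′ (basis v) ⟩
    ≡⟨ ⟨∣σ-basis⟩ _ m u ⟩
  σᵀ m (λ p → ⟨ harmIdxᵀ g p ∣ σ m′ (basis v) ⟩) u
    ≡⟨ ⟨∣⟩-cong (σIdx m u) (λ p → ⟨∣σ-basis⟩ (harmIdxᵀ g p) m′ v) ⟩
  ⟨ harmIdxᵀ g ∣ σIdx m u ⊗ σIdx m′ v ⟩
    ∎

⟨∣IIdx⟩ : ∀ g m m′ k → ⟨ g ∣ IIdx m m′ k ⟩ ≡
          ∑ (upTo (suc (length k))) (λ i → sgn (sum (drop i k)) *
                                          ⟨ harmIdxᵀ g ∣ σIdx m (take i k) ⊗ σIdx m′ (reverse (drop i k)) ⟩)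
⟨∣IIdx⟩ g m m′ k =
  trans (∑-concatMap (λ i → scale (sign i) (product i)) cuts (λ (c , w) → c * g w))
        (∑-cong cuts (λ i → trans (⟨∣scale⟩ g (sign i) (product i))
                                  (cong (sign i *_) (⟨∣σ⋆σ⟩ g m m′ (take i k) (reverse (drop i k))))))
  where
  cuts : List ℕ
  cuts = upTo (suc (length k))
  sign : ℕ → ℚ
  sign i = sgn (sum (drop i k))
  product : ℕ → Lin
  product i = σ m (basis (take i k)) ⋆ σ m′ (basis (reverse (drop i k)))

conv-⟨∣IIdx⟩ : ∀ n g k → conv (λ i j → ⟨ g ∣ IIdx i j k ⟩) n ≡ ⟨ σᵀ n g ∣ IIdx 0 0 k ⟩
conv-⟨∣IIdx⟩ n g k = begin
  conv (λ i j → ⟨ g ∣ IIdx i j k ⟩) n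
    ≡⟨ conv-cong n (λ i j → ⟨∣IIdx⟩ g i j k) ⟩
  conv (λ i j → ∑ cuts (λ c → sign c * ⟨ harmIdxᵀ g ∣ σIdx i (front c) ⊗ σIdx j (back c) ⟩)) n
    ≡⟨ ∑-conv cuts (λ c i j → sign c * ⟨ harmIdxᵀ g ∣ σIdx i (front c) ⊗ σIdx j (back c) ⟩) n ⟨
  ∑ cuts (λ c → conv (λ i j → sign c * ⟨ harmIdxᵀ g ∣ σIdx i (front c) ⊗ σIdx j (back c) ⟩) n)
    ≡⟨ ∑-cong cuts (λ c → conv-*ˡ (sign c) _ n) ⟩
  ∑ cuts (λ c → sign c * σ⊗ᵀ n (harmIdxᵀ g) (front c) (back c))
    ≡⟨ ∑-cong cuts (λ c → cong (sign c *_) (σᵀ-harmIdx n g (front c) (back c))) ⟨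
  ∑ cuts (λ c → sign c * harmIdxᵀ (σᵀ n g) (front c) (back c))
    ≡⟨ ∑-cong cuts (λ c → cong (sign c *_) (σᵀ₀⊗σᵀ₀ (harmIdxᵀ (σᵀ n g)) (front c) (back c))) ⟨
  ∑ cuts (λ c → sign c * ⟨ harmIdxᵀ (σᵀ n g) ∣ σIdx 0 (front c) ⊗ σIdx 0 (back c) ⟩)
    ≡⟨ ⟨∣IIdx⟩ (σᵀ n g) 0 0 k ⟨
  ⟨ σᵀ n g ∣ IIdx 0 0 k ⟩
    ∎
  where
  cuts : List ℕ
  cuts = upTo (suc (length k))
  sign : ℕ → ℚ
  sign c = sgn (sum (drop c k))
  front back : ℕ → Index
  front c = take c k
  back  c = reverse (drop c k)
  σᵀ₀⊗σᵀ₀ : ∀ F u v → ⟨ F ∣ σIdx 0 u ⊗ σIdx 0 v ⟩ ≡ F u v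
  σᵀ₀⊗σᵀ₀ F u v = trans (σᵀ-zero _ u) (σᵀ-zero (F u) v)

Σ≤-I₂≐σ-I₀ : ∀ n x → Σ≤ n (λ i → I₂ i (n ∸ i) x) ≐ σ n (I 0 x)
Σ≤-I₂≐σ-I₀ n x g = begin
  ⟨ g ∣ Σ≤ n (λ i → I₂ i (n ∸ i) x) ⟩
    ≡⟨ ∑-concatMap (λ i → I₂ i (n ∸ i) x) (upTo (suc n)) _ ⟩
  ∑ (upTo (suc n)) (λ i → ⟨ g ∣ I₂ i (n ∸ i) x ⟩)
    ≡⟨ ∑-upTo-conv (λ i j → ⟨ g ∣ I₂ i j x ⟩) n ⟩
  conv (λ i j → ⟨ g ∣ I₂ i j x ⟩) n
    ≡⟨ conv-cong n (λ i j → ⟨∣linExt⟩ g (IIdx i j) x) ⟩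
  conv (λ i j → ⟨ (λ k → ⟨ g ∣ IIdx i j k ⟩) ∣ x ⟩) n
    ≡⟨ ⟨∣⟩-conv (λ i j k → ⟨ g ∣ IIdx i j k ⟩) n x ⟨
  ⟨ (λ k → conv (λ i j → ⟨ g ∣ IIdx i j k ⟩) n) ∣ x ⟩
    ≡⟨ ⟨∣⟩-cong x (conv-⟨∣IIdx⟩ n g) ⟩
  ⟨ (λ k → ⟨ σᵀ n g ∣ IIdx 0 0 k ⟩) ∣ x ⟩
    ≡⟨ ⟨∣linExt⟩ (σᵀ n g) (IIdx 0 0) x ⟨
  ⟨ σᵀ n g ∣ I 0 x ⟩
    ≡⟨ ⟨∣linExt⟩ g (σIdx n) (I 0 x) ⟨
  ⟨ g ∣ σ n (I 0 x) ⟩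
    ∎

-- Positivity of the entries is not needed: the identity holds for every list of naturals.
lemma2p2 : (n : ℕ) (k : List ℕ) → All NonZero k →
    Σ≤ n (λ i → I₂ i (n ∸ i) (basis k)) ≈ σ n (I 0 (basis k))
lemma2p2 n k _ =
  ≐⇒≈ {Σ≤ n (λ i → I₂ i (n ∸ i) (basis k))} {σ n (I 0 (basis k))} (Σ≤-I₂≐σ-I₀ n (basis k))
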